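{- Let $J\subseteq C(n,k)$ be a realizable $k$-set and $Y\in C(n,k+2)$. Write $A<B$ if every element of $A$ is lexicographically smaller than every element of $B$. Then none of the following occurs: (a) $P_Y=(P_Y\cap J_F)\cup(P_Y\cap J_s)$ with both parts nonempty and $P_Y\cap J_F<P_Y\cap J_s$; (b) $P_Y=(P_Y\cap J_p)\cup(P_Y\cap J_F)$ with both parts nonempty and $P_Y\cap J_p<P_Y\cap J_F$; (c) $P_Y=(P_Y\cap J_s)\cup(P_Y\cap J_\emptyset)$ with both parts nonempty and $P_Y\cap J_s<P_Y\cap J_\emptyset$; (d) $P_Y=(P_Y\cap J_\emptyset)\cup(P_Y\cap J_p)$ with both parts nonempty and $P_Y\cap J_\emptyset<P_Y\cap J_p$.
   Context: $C(n,m)$: $m$-subsets of $\{1,\dots,n\}$ with lexicographic order on increasing sequences. For $X\in C(n,m+1)$, $P_X=\{Z\in C(n,m):Z\subset X\}$ with induced lexicographic order; prefix/suffix = initial/final segment (possibly empty or all). For $A\subseteq C(n,k)$ define subsets of $C(n,k+1)$: $A_p$ (resp. $A_s$) = $\{X:P_X\cap A$ a nonempty prefix (resp. suffix) of $P_X$, $\ne P_X\}$, $A_F=\{X:P_X\subseteq A\}$, $A_\emptyset=\{X:P_X\cap A=\emptyset\}$. $A$ is a realizable $k$-set if $P_X\cap A$ is a prefix or suffix of $P_X$ for every $X\in C(n,k+1)$. -}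

module Defs where

open import Data.Nat using (ℕ; suc; _<_; _≤_)
open import Data.List using (List; []; _∷_; length)
open import Data.List.Relation.Unary.All using (All)
open import Data.List.Relation.Unary.Linked using (Linked)
open import Data.List.Membership.Propositional using (_∈_)
open import Data.Product using (Σ; _×_; ∃; ∃-syntax)
open import Data.Sum using (_⊎_)
open import Relation.Nullary using (¬_)
open import Relation.Binary.PropositionalEquality using (_≡_)

-- An m-subset of {1,…,n}, represented as its strictly increasing list of elements.
Comb : ℕ → ℕ → List ℕ → Set
Comb n m xs = (length xs ≡ m) × All (λ x → 1 ≤ x × x ≤ n) xs × Linked _<_ xs

data Lex< : List ℕ → List ℕ → Set where
  here  : ∀ {x y xs ys} → x < y → Lex< (x ∷ xs) (y ∷ ys)
  there : ∀ {x xs ys} → Lex< xs ys → Lex< (x ∷ xs) (x ∷ ys)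

_⊆ₗ_ : List ℕ → List ℕ → Set
Z ⊆ₗ X = All (_∈ X) Z

-- Z ∈ P_X, where X ∈ C(n,m+1) and Z ∈ C(n,m).
InP : ℕ → ℕ → List ℕ → List ℕ → Set
InP n m X Z = Comb n m Z × Z ⊆ₗ X

Family : Set₁
Family = List ℕ → Set

FamilyOf : ℕ → ℕ → Family → Set
FamilyOf n k A = ∀ Z → A Z → Comb n k Z

IsPrefix : ℕ → ℕ → Family → List ℕ → Set
IsPrefix n k A X = ∀ Z Z′ → InP n k X Z → InP n k X Z′ → Lex< Z Z′ → A Z′ → A Z

IsSuffix : ℕ → ℕ → Family → List ℕ → Set
IsSuffix n k A X = ∀ Z Z′ → InP n k X Z → InP n k X Z′ → Lex< Z Z′ → A Z → A Z′

Realizable : ℕ → ℕ → Family → Set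
Realizable n k A = FamilyOf n k A × (∀ X → Comb n (suc k) X → IsPrefix n k A X ⊎ IsSuffix n k A X)

MeetsA : ℕ → ℕ → Family → List ℕ → Set
MeetsA n k A X = ∃[ Z ] (InP n k X Z × A Z)

MissesA : ℕ → ℕ → Family → List ℕ → Set
MissesA n k A X = ∃[ Z ] (InP n k X Z × ¬ A Z)

Aₚ : ℕ → ℕ → Family → Family
Aₚ n k A X = Comb n (suc k) X × IsPrefix n k A X × MeetsA n k A X × MissesA n k A X

Aₛ : ℕ → ℕ → Family → Family
Aₛ n k A X = Comb n (suc k) X × IsSuffix n k A X × MeetsA n k A X × MissesA n k A X

A-F : ℕ → ℕ → Family → Family
A-F n k A X = Comb n (suc k) X × (∀ Z → InP n k X Z → A Z)

A-∅ : ℕ → ℕ → Family → Family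
A-∅ n k A X = Comb n (suc k) X × (∀ Z → InP n k X Z → ¬ A Z)

SplitLT : ℕ → ℕ → List ℕ → Family → Family → Set
SplitLT n k Y B C =
  (∀ W → InP n (suc k) Y W → B W ⊎ C W)
  × (∃[ W ] (InP n (suc k) Y W × B W))
  × (∃[ W ] (InP n (suc k) Y W × C W))
  × (∀ W W′ → InP n (suc k) Y W → InP n (suc k) Y W′ → B W → C W′ → Lex< W W′)

-- For Y ∈ C(n,k+2) the lexicographically least member of P_Y is Y without its last
-- element and the greatest is Y without its first element; the set Z obtained by
-- removing both ends is the greatest member of P_(Y∖last) and the least member of
-- P_(Y∖first).  In a split P_Y = B ∪ C with B < C, the least member lies in B and
-- the greatest in C.  In each of the four configurations the prefix or suffix
-- shape of P_X ∩ J then transports membership in J through Z, contradicting the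
-- defining property of J_F, J_∅, J_p or J_s.
module Submission where

open import Defs
open import Data.Nat using (ℕ; suc; _<_)
open import Data.Nat.Properties using (<-trans; <-irrefl; suc-injective)
open import Data.List using (List; []; _∷_; length)
open import Data.List.Relation.Unary.All as All using (All; []; _∷_)
open import Data.List.Relation.Unary.Any using (here; there)
open import Data.List.Relation.Unary.Linked as Linked using (Linked; []; [-]; _∷_)
open import Data.List.Relation.Unary.Linked.Properties using (Linked⇒All)
open import Data.List.Relation.Binary.Sublist.Propositional as Sublist
  using ([]; _∷_; _∷ʳ_; minimum; ⊆-refl) renaming (_⊆_ to _⊑_)
open import Data.List.Relation.Binary.Sublist.Propositional.Properties using (All-resp-⊆; to-≋)
open import Data.List.Relation.Binary.Pointwise using (Pointwise-≡⇒≡)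
open import Data.Product using (_×_; _,_; proj₁)
open import Data.Sum using (_⊎_; inj₁; inj₂)
open import Data.Empty using (⊥-elim)
open import Relation.Nullary using (¬_)
open import Relation.Binary.PropositionalEquality using (_≡_; refl; sym; trans; cong; subst)

infix 4 _≤ₗ_

_≤ₗ_ : List ℕ → List ℕ → Set
W ≤ₗ W′ = W ≡ W′ ⊎ Lex< W W′

Lex<-trans : ∀ {a b c} → Lex< a b → Lex< b c → Lex< a c
Lex<-trans (here p)  (here q)  = here (<-trans p q)
Lex<-trans (here p)  (there q) = here p
Lex<-trans (there p) (here q)  = here q
Lex<-trans (there p) (there q) = there (Lex<-trans p q)

Lex<-irrefl : ∀ {a} → ¬ Lex< a a
Lex<-irrefl (here p)  = <-irrefl refl p
Lex<-irrefl (there p) = Lex<-irrefl p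

Lex<⇒≱ₗ : ∀ {a b} → Lex< a b → ¬ b ≤ₗ a
Lex<⇒≱ₗ a<b (inj₁ refl) = Lex<-irrefl a<b
Lex<⇒≱ₗ a<b (inj₂ b<a)  = Lex<-irrefl (Lex<-trans a<b b<a)

∷-mono-≤ₗ : ∀ {x W W′} → W ≤ₗ W′ → x ∷ W ≤ₗ x ∷ W′
∷-mono-≤ₗ (inj₁ refl) = inj₁ refl
∷-mono-≤ₗ (inj₂ W<W′) = inj₂ (there W<W′)

dropLast : List ℕ → List ℕ
dropLast []           = []
dropLast (x ∷ [])     = []
dropLast (x ∷ y ∷ ys) = x ∷ dropLast (y ∷ ys)

dropLast-⊑ : ∀ xs → dropLast xs ⊑ xs
dropLast-⊑ []           = []
dropLast-⊑ (x ∷ [])     = x ∷ʳ []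
dropLast-⊑ (x ∷ y ∷ ys) = refl ∷ dropLast-⊑ (y ∷ ys)

length-dropLast : ∀ x xs → length (dropLast (x ∷ xs)) ≡ length xs
length-dropLast x []       = refl
length-dropLast x (y ∷ ys) = cong suc (length-dropLast y ys)

dropLast-Linked : ∀ {xs} → Linked _<_ xs → Linked _<_ (dropLast xs)
dropLast-Linked []                = []
dropLast-Linked [-]               = []
dropLast-Linked (x<y ∷ [-])       = [-]
dropLast-Linked (x<y ∷ l@(_ ∷ _)) = x<y ∷ dropLast-Linked l

head<tail : ∀ {x xs} → Linked _<_ (x ∷ xs) → All (x <_) xs
head<tail [-]       = []
head<tail (x<y ∷ l) = Linked⇒All <-trans x<y l

⊑⇒⊆ₗ : ∀ {W X} → W ⊑ X → W ⊆ₗ X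
⊑⇒⊆ₗ τ = All.tabulate (Sublist.lookup τ)

⊆ₗ-∷⁻ : ∀ {x xs L} → All (x <_) L → L ⊆ₗ (x ∷ xs) → L ⊆ₗ xs
⊆ₗ-∷⁻ []          []                = []
⊆ₗ-∷⁻ (x<e ∷ x<L) (here refl ∷ L⊆) = ⊥-elim (<-irrefl refl x<e)
⊆ₗ-∷⁻ (x<e ∷ x<L) (there e∈ ∷ L⊆)  = e∈ ∷ ⊆ₗ-∷⁻ x<L L⊆

increasing-⊆ₗ⇒⊑ : ∀ {W X} → Linked _<_ W → Linked _<_ X → W ⊆ₗ X → W ⊑ X
increasing-⊆ₗ⇒⊑ {[]}     _  _  _ = minimum _
increasing-⊆ₗ⇒⊑ {w ∷ ws} {x ∷ xs} lW lX (here refl ∷ ws⊆) =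
  refl ∷ increasing-⊆ₗ⇒⊑ (Linked.tail lW) (Linked.tail lX) (⊆ₗ-∷⁻ (head<tail lW) ws⊆)
increasing-⊆ₗ⇒⊑ {w ∷ ws} {x ∷ xs} lW lX (there w∈xs ∷ ws⊆) =
  x ∷ʳ increasing-⊆ₗ⇒⊑ lW (Linked.tail lX) (w∈xs ∷ ⊆ₗ-∷⁻ x<ws ws⊆)
  where
  x<ws : All (x <_) ws
  x<ws = All.map (<-trans (All.lookup (head<tail lX) w∈xs)) (head<tail lW)

⊑-length-≡⇒≡ : ∀ {W X} → W ⊑ X → length W ≡ length X → W ≡ X
⊑-length-≡⇒≡ τ eq = Pointwise-≡⇒≡ (to-≋ {A = ℕ} eq τ)

⊑⇒≤ₗ-tail : ∀ {x xs W} → Linked _<_ (x ∷ xs) → W ⊑ x ∷ xs → length W ≡ length xs → W ≤ₗ xs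
⊑⇒≤ₗ-tail _           (_ ∷ʳ τ)   eq = inj₁ (⊑-length-≡⇒≡ τ eq)
⊑⇒≤ₗ-tail (x<x′ ∷ _) (refl ∷ τ) eq = inj₂ (here x<x′)

⊑⇒dropLast-≤ₗ : ∀ {X W} → Linked _<_ X → W ⊑ X → suc (length W) ≡ length X → dropLast X ≤ₗ W
⊑⇒dropLast-≤ₗ {x ∷ []}      _          (_ ∷ʳ [])  _  = inj₁ refl
⊑⇒dropLast-≤ₗ {x ∷ x′ ∷ xs} (x<x′ ∷ _) (_ ∷ʳ τ)   eq =
  inj₂ (subst (Lex< _) (sym (⊑-length-≡⇒≡ τ (suc-injective eq))) (here x<x′))
⊑⇒dropLast-≤ₗ {x ∷ x′ ∷ xs} (_ ∷ lX)   (refl ∷ τ) eq =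
  ∷-mono-≤ₗ (⊑⇒dropLast-≤ₗ lX τ (suc-injective eq))

Least : ℕ → ℕ → List ℕ → List ℕ → Set
Least n m X Z = InP n m X Z × (∀ Z′ → InP n m X Z′ → Z ≤ₗ Z′)

Greatest : ℕ → ℕ → List ℕ → List ℕ → Set
Greatest n m X Z = InP n m X Z × (∀ Z′ → InP n m X Z′ → Z′ ≤ₗ Z)

Comb-tail : ∀ {n m x xs} → Comb n (suc m) (x ∷ xs) → Comb n m xs
Comb-tail (len , _ ∷ bounds , lX) = suc-injective len , bounds , Linked.tail lX

Comb-dropLast : ∀ {n m X} → Comb n (suc m) X → Comb n m (dropLast X)
Comb-dropLast {X = x ∷ xs} (len , bounds , lX) =
  trans (length-dropLast x xs) (suc-injective len) ,
  All-resp-⊆ (dropLast-⊑ (x ∷ xs)) bounds ,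
  dropLast-Linked lX

dropLast-least : ∀ {n m X} → Comb n (suc m) X → Least n m X (dropLast X)
dropLast-least {X = X} cX@(lenX , _ , lX) =
  (Comb-dropLast cX , ⊑⇒⊆ₗ (dropLast-⊑ X)) ,
  λ { Z ((lenZ , _ , lZ) , Z⊆X) →
      ⊑⇒dropLast-≤ₗ lX (increasing-⊆ₗ⇒⊑ lZ lX Z⊆X) (trans (cong suc lenZ) (sym lenX)) }

tail-greatest : ∀ {n m x xs} → Comb n (suc m) (x ∷ xs) → Greatest n m (x ∷ xs) xs
tail-greatest {x = x} cX@(lenX , _ , lX) =
  (Comb-tail cX , ⊑⇒⊆ₗ (x ∷ʳ ⊆-refl)) ,
  λ { Z ((lenZ , _ , lZ) , Z⊆X) →
      ⊑⇒≤ₗ-tail lX (increasing-⊆ₗ⇒⊑ lZ lX Z⊆X) (trans lenZ (sym (suc-injective lenX))) }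

module _ {n k : ℕ} {A : Family} {X : List ℕ} where

  prefix-downward : IsPrefix n k A X → ∀ {Z Z′} → InP n k X Z → InP n k X Z′ →
                    Z ≤ₗ Z′ → A Z′ → A Z
  prefix-downward _      _  _   (inj₁ refl) AZ′ = AZ′
  prefix-downward prefix Z∈ Z′∈ (inj₂ Z<Z′)     = prefix _ _ Z∈ Z′∈ Z<Z′

  suffix-upward : IsSuffix n k A X → ∀ {Z Z′} → InP n k X Z → InP n k X Z′ →
                  Z ≤ₗ Z′ → A Z → A Z′
  suffix-upward _      _  _   (inj₁ refl) AZ = AZ
  suffix-upward suffix Z∈ Z′∈ (inj₂ Z<Z′)    = suffix _ _ Z∈ Z′∈ Z<Z′

  prefix∋greatest⇒¬misses : IsPrefix n k A X → ∀ {Z} → Greatest n k X Z → A Z → ¬ MissesA n k A X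
  prefix∋greatest⇒¬misses prefix (Z∈ , greatest) AZ (Z′ , Z′∈ , ¬AZ′) =
    ¬AZ′ (prefix-downward prefix Z′∈ Z∈ (greatest Z′ Z′∈) AZ)

  suffix∋least⇒¬misses : IsSuffix n k A X → ∀ {Z} → Least n k X Z → A Z → ¬ MissesA n k A X
  suffix∋least⇒¬misses suffix (Z∈ , least) AZ (Z′ , Z′∈ , ¬AZ′) =
    ¬AZ′ (suffix-upward suffix Z∈ Z′∈ (least Z′ Z′∈) AZ)

  prefix-meets⇒∋least : IsPrefix n k A X → ∀ {Z} → Least n k X Z → MeetsA n k A X → A Z
  prefix-meets⇒∋least prefix (Z∈ , least) (Z′ , Z′∈ , AZ′) =
    prefix-downward prefix Z∈ Z′∈ (least Z′ Z′∈) AZ′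

  suffix-meets⇒∋greatest : IsSuffix n k A X → ∀ {Z} → Greatest n k X Z → MeetsA n k A X → A Z
  suffix-meets⇒∋greatest suffix (Z∈ , greatest) (Z′ , Z′∈ , AZ′) =
    suffix-upward suffix Z′∈ Z∈ (greatest Z′ Z′∈) AZ′

module _ {n k : ℕ} {J : Family} {B A Z : List ℕ}
         (Z-greatest : Greatest n k B Z) (Z-least : Least n k A Z) where

  A-F-then-Aₛ-impossible : A-F n k J B → ¬ Aₛ n k J A
  A-F-then-Aₛ-impossible (_ , full) (_ , suffix , _ , misses) =
    suffix∋least⇒¬misses suffix Z-least (full Z (proj₁ Z-greatest)) misses

  Aₚ-then-A-F-impossible : Aₚ n k J B → ¬ A-F n k J A
  Aₚ-then-A-F-impossible (_ , prefix , _ , misses) (_ , full) =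
    prefix∋greatest⇒¬misses prefix Z-greatest (full Z (proj₁ Z-least)) misses

  Aₛ-then-A-∅-impossible : Aₛ n k J B → ¬ A-∅ n k J A
  Aₛ-then-A-∅-impossible (_ , suffix , meets , _) (_ , empty) =
    empty Z (proj₁ Z-least) (suffix-meets⇒∋greatest suffix Z-greatest meets)

  A-∅-then-Aₚ-impossible : A-∅ n k J B → ¬ Aₚ n k J A
  A-∅-then-Aₚ-impossible (_ , empty) (_ , prefix , meets , _) =
    empty Z (proj₁ Z-greatest) (prefix-meets⇒∋least prefix Z-least meets)

SplitLT-least : ∀ {n k Y C D W} → SplitLT n k Y C D → Least n (suc k) Y W → C W
SplitLT-least (cover , (W′ , W′∈ , CW′) , _ , ordered) (W∈ , least) with cover _ W∈
... | inj₁ CW = CW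
... | inj₂ DW = ⊥-elim (Lex<⇒≱ₗ (ordered _ _ W′∈ W∈ CW′ DW) (least W′ W′∈))

SplitLT-greatest : ∀ {n k Y C D W} → SplitLT n k Y C D → Greatest n (suc k) Y W → D W
SplitLT-greatest (cover , _ , (W′ , W′∈ , DW′) , ordered) (W∈ , greatest) with cover _ W∈
... | inj₂ DW = DW
... | inj₁ CW = ⊥-elim (Lex<⇒≱ₗ (ordered _ _ W∈ W′∈ CW DW′) (greatest W′ W′∈))

corollary3p17 : (n k : ℕ) (J : Family) → Realizable n k J →
    (Y : List ℕ) → Comb n (suc (suc k)) Y →
      ¬ SplitLT n k Y (A-F n k J) (Aₛ n k J)
      × ¬ SplitLT n k Y (Aₚ n k J) (A-F n k J)
      × ¬ SplitLT n k Y (Aₛ n k J) (A-∅ n k J)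
      × ¬ SplitLT n k Y (A-∅ n k J) (Aₚ n k J)
corollary3p17 n k J _ []           (() , _)
corollary3p17 n k J _ (y ∷ [])     (() , _)
corollary3p17 n k J _ (y ∷ y′ ∷ ys) cY =
    excluded A-F-then-Aₛ-impossible
  , excluded Aₚ-then-A-F-impossible
  , excluded Aₛ-then-A-∅-impossible
  , excluded A-∅-then-Aₚ-impossible
  where
  excluded : ∀ {C D : Family} →
             (Greatest n k (dropLast (y ∷ y′ ∷ ys)) (dropLast (y′ ∷ ys)) →
              Least n k (y′ ∷ ys) (dropLast (y′ ∷ ys)) →
              C (dropLast (y ∷ y′ ∷ ys)) → ¬ D (y′ ∷ ys)) →
             ¬ SplitLT n k (y ∷ y′ ∷ ys) C D
  excluded clash split =
    clash (tail-greatest (Comb-dropLast cY)) (dropLast-least (Comb-tail cY))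
          (SplitLT-least split (dropLast-least cY)) (SplitLT-greatest split (tail-greatest cY))
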